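{- Let $n>2$ be an integer and let ${}_n\mathcal{A}$ be the $g_n\times g_n$ matrix of $n$-variable rotation symmetric Boolean functions (defined in the context). Then $$\mathrm{Tr}({}_n\mathcal{A})=\frac1n\sum_{\sigma\in C_n}\sum_{x\in\mathbb{F}_2^n}(-1)^{x\cdot\sigma x}.$$
   Context: For $x,y\in\mathbb{F}_2^n$, $x\cdot y=\sum_{i=1}^n x_iy_i\in\mathbb{F}_2$, and $(-1)^{a}$ for $a\in\mathbb{F}_2$ means $1$ if $a=0$ and $-1$ if $a=1$. Let $\rho_n(x_1,x_2,\dots,x_n)=(x_2,\dots,x_n,x_1)$ be the cyclic shift on $\mathbb{F}_2^n$ and $C_n=\langle\rho_n\rangle$ the cyclic group (of order $n$) it generates, acting on $\mathbb{F}_2^n$. Let $g_n$ be the number of orbits of this action. In each orbit choose as representative $\Lambda_{n,i}$ its lexicographically first element, indexing orbits $G_{n,i}$ ($0\le i\le g_n-1$) so that $\Lambda_{n,0},\dots,\Lambda_{n,g_n-1}$ are in lexicographic order, $G_{n,i}$ being the orbit of $\Lambda_{n,i}$. The matrix ${}_n\mathcal{A}$ has $(i,j)$ entry $\sum_{x\in G_{n,i}}(-1)^{x\cdot\Lambda_{n,j}}$. -}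

module Defs where

open import Data.Bool using (Bool; true; false; _∧_; _xor_; if_then_else_)
open import Data.Nat using (ℕ; zero; suc)
open import Data.Fin using (Fin)
open import Data.Integer using (ℤ; +_; -_)
import Data.Integer as ℤ
open import Data.List using (List; []; _∷_; _++_; map; filter; length; upTo; allFin; foldr)
open import Data.Bool.ListAction using (any; all)
import Data.List as List
open import Data.Vec using (Vec; []; _∷_; _∷ʳ_)
import Data.Vec as Vec
open import Data.Vec.Properties using (≡-dec)
import Data.Bool.Properties as BoolP
open import Relation.Nullary.Decidable using (⌊_⌋)
open import Relation.Unary using (Decidable)

-- Elements of F₂ⁿ are Vec Bool n (false = 0, true = 1).

sumℤ : List ℤ → ℤ
sumℤ = foldr ℤ._+_ (+ 0)

allVecs : (n : ℕ) → List (Vec Bool n)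
allVecs zero = [] ∷ []
allVecs (suc n) = map (false ∷_) (allVecs n) ++ map (true ∷_) (allVecs n)

lexLeq : ∀ {n} → Vec Bool n → Vec Bool n → Bool
lexLeq [] [] = true
lexLeq (false ∷ xs) (false ∷ ys) = lexLeq xs ys
lexLeq (true ∷ xs) (true ∷ ys) = lexLeq xs ys
lexLeq (false ∷ xs) (true ∷ ys) = true
lexLeq (true ∷ xs) (false ∷ ys) = false

ρ : ∀ {n} → Vec Bool n → Vec Bool n
ρ [] = []
ρ (x ∷ xs) = xs ∷ʳ x

ρ^ : ∀ {n} → ℕ → Vec Bool n → Vec Bool n
ρ^ zero x = x
ρ^ (suc k) x = ρ (ρ^ k x)

dot : ∀ {n} → Vec Bool n → Vec Bool n → Bool
dot [] [] = false
dot (x ∷ xs) (y ∷ ys) = (x ∧ y) xor dot xs ys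

sgn : Bool → ℤ
sgn false = + 1
sgn true = - (+ 1)

_≟v_ : ∀ {n} → (x y : Vec Bool n) → _
_≟v_ = ≡-dec BoolP._≟_

inOrbit : ∀ {n} → Vec Bool n → Vec Bool n → Bool
inOrbit {n} x y = any (λ k → ⌊ ρ^ k x ≟v y ⌋) (upTo n)

isRep : ∀ {n} → Vec Bool n → Bool
isRep {n} x = all (λ k → lexLeq x (ρ^ k x)) (upTo n)

-- Λ_{n,0}, …, Λ_{n,g_n-1} in lexicographic order.
reps : (n : ℕ) → List (Vec Bool n)
reps n = filter (λ x → isRep x Data.Bool.≟ true) (allVecs n)

g : ℕ → ℕ
g n = length (reps n)

Λ : (n : ℕ) → Fin (g n) → Vec Bool n
Λ n i = List.lookup (reps n) i

G : (n : ℕ) → Fin (g n) → List (Vec Bool n)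
G n i = filter (λ y → inOrbit (Λ n i) y Data.Bool.≟ true) (allVecs n)

𝒜 : (n : ℕ) → Fin (g n) → Fin (g n) → ℤ
𝒜 n i j = sumℤ (map (λ x → sgn (dot x (Λ n j))) (G n i))

Tr : (n : ℕ) → ℤ
Tr n = sumℤ (map (λ i → 𝒜 n i i) (allFin (g n)))

-- Σ_{σ ∈ C_n} Σ_{x ∈ F₂ⁿ} (-1)^{x · σx}, with C_n = {ρ^k : 0 ≤ k < n}.
rhsSum : (n : ℕ) → ℤ
rhsSum n = sumℤ (map (λ k → sumℤ (map (λ x → sgn (dot x (ρ^ k x))) (allVecs n))) (upTo n))

-- Let h(x) = Σ_{k<n} (-1)^{x·ρᵏx}, so that the right-hand side is Σ_x h(x), and let
-- T(r) = Σ_{x ∈ G(r)} (-1)^{x·r} be the diagonal entry of a representative r.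
-- Averaging over the n rotations, which permute F₂ⁿ and preserve G(r) and the dot
-- product,  n·T(r) = Σ_{k<n} Σ_{x ∈ G(r)} (-1)^{ρᵏx·r} = Σ_{x ∈ G(r)} h(x):  for
-- r = ρᶜx the inner sum is h(x) with its index shifted by c, and k ↦ (-1)^{ρᵏx·ρᶜx}
-- has period n.  Summing over the representatives counts every x exactly once,
-- in the orbit of its lexicographic minimum.
module Submission where

open import Defs
open import Level using (0ℓ)
open import Function using (_∘_; _⇔_; mk⇔; Equivalence)
import Function.Properties.Equivalence as ⇔
open import Data.Unit using (tt)
open import Data.Product using (_×_; _,_)
open import Data.Sum using (_⊎_; inj₁; inj₂)
open import Data.Bool using (Bool; true; false; T; _∧_; _xor_)
import Data.Bool as Bool
open import Data.Bool.Properties using (T-≡; T-∧; ⇔→≡; xor-comm; xor-assoc; ∧-comm)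
open import Data.Nat as ℕ using (ℕ; zero; suc; _<_; _%_; _/_; NonZero)
open import Data.Nat.Properties using (+-comm; +-suc; *-suc; +-identityʳ)
open import Data.Nat.DivMod using (m≡m%n+[m/n]*n; m%n<n)
open import Data.Integer as ℤ using (ℤ; +_; 0ℤ; _+_; _*_)
import Data.Integer.Properties as ℤ
open import Data.List using (List; []; _∷_; _++_; [_]; map; filter; length; upTo; tabulate; allFin)
import Data.List as List
open import Data.List.Properties using (++-assoc; ++-identityʳ; ∷-injective; map-cong; map-∘; map-upTo; upTo-∷ʳ; length-upTo; map-tabulate; tabulate-lookup)
import Data.List.Relation.Unary.All as All
open import Data.List.Relation.Unary.All.Properties using (all⁺; all⁻; map⁺)
import Data.List.Relation.Unary.Any as Any
open import Data.List.Relation.Unary.Any.Properties using (any⁺; any⁻)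
open import Data.List.Membership.Propositional using (lose)
open import Data.List.Membership.Propositional.Properties using (∈-upTo⁺; ∈-map⁺)
open import Data.Vec using (Vec; []; _∷_; _∷ʳ_; toList)
open import Data.Vec.Properties using (toList-injective; toList-∷ʳ; length-toList)
open import Data.Vec.Relation.Binary.Equality.Cast using (cast-is-id)
open import Relation.Binary.Bundles using (TotalOrder)
open import Algebra.Bundles using (AbelianGroup)
open import Relation.Binary.PropositionalEquality hiding ([_])
open import Relation.Nullary.Decidable using (⌊_⌋; toWitness; fromWitness; isYes≗does)
import Data.List.Extrema

open ≡-Reasoning

private
  variable
    A B : Set
    n : ℕ

T-⇔⇒≡ : {a b : Bool} → T a ⇔ T b → a ≡ b
T-⇔⇒≡ a⇔b = ⇔→≡ {z = true} (⇔.trans (⇔.sym T-≡) (⇔.trans a⇔b T-≡))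

toList-injective′ : {x y : Vec A n} → toList x ≡ toList y → x ≡ y
toList-injective′ {x = x} {y} eq = trans (sym (cast-is-id refl x)) (toList-injective refl x y eq)

ρ^-+ : ∀ a b (x : Vec Bool n) → ρ^ (a ℕ.+ b) x ≡ ρ^ a (ρ^ b x)
ρ^-+ zero    b x = refl
ρ^-+ (suc a) b x = cong ρ (ρ^-+ a b x)

ρ^-suc : ∀ k (x : Vec Bool n) → ρ^ (suc k) x ≡ ρ^ k (ρ x)
ρ^-suc k x = trans (cong (λ j → ρ^ j x) (+-comm 1 k)) (ρ^-+ k 1 x)

toList-ρ^-++ : ∀ xs ys (w : Vec Bool n) → toList w ≡ xs ++ ys →
               toList (ρ^ (length xs) w) ≡ ys ++ xs
toList-ρ^-++ []       ys w       eq = trans eq (sym (++-identityʳ ys))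
toList-ρ^-++ (x ∷ xs) ys (y ∷ w) eq with refl , eq′ ← ∷-injective eq = begin
  toList (ρ^ (suc (length xs)) (x ∷ w)) ≡⟨ cong toList (ρ^-suc (length xs) (x ∷ w)) ⟩
  toList (ρ^ (length xs) (w ∷ʳ x))      ≡⟨ toList-ρ^-++ xs (ys ++ [ x ]) (w ∷ʳ x) toList-w∷ʳx ⟩
  (ys ++ [ x ]) ++ xs                   ≡⟨ ++-assoc ys [ x ] xs ⟩
  ys ++ x ∷ xs                          ∎
  where
  toList-w∷ʳx : toList (w ∷ʳ x) ≡ xs ++ ys ++ [ x ]
  toList-w∷ʳx = trans (toList-∷ʳ x w) (trans (cong (_++ [ x ]) eq′) (++-assoc xs ys [ x ]))

ρ^-period : (x : Vec Bool n) → ρ^ n x ≡ x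
ρ^-period {n} x = toList-injective′ (subst (λ k → toList (ρ^ k x) ≡ toList x) (length-toList x)
  (toList-ρ^-++ (toList x) [] x (sym (++-identityʳ (toList x)))))

ρ^-multiple : ∀ q (x : Vec Bool n) → ρ^ (q ℕ.* n) x ≡ x
ρ^-multiple         zero    x = refl
ρ^-multiple {n = n} (suc q) x = begin
  ρ^ (n ℕ.+ q ℕ.* n) x  ≡⟨ ρ^-+ n (q ℕ.* n) x ⟩
  ρ^ n (ρ^ (q ℕ.* n) x) ≡⟨ cong (ρ^ n) (ρ^-multiple q x) ⟩
  ρ^ n x                ≡⟨ ρ^-period x ⟩
  x                     ∎

ρ^-% : ∀ k (x : Vec Bool n) .{{_ : NonZero n}} → ρ^ k x ≡ ρ^ (k % n) x
ρ^-% {n} k x = begin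
  ρ^ k x                            ≡⟨ cong (λ j → ρ^ j x) (m≡m%n+[m/n]*n k n) ⟩
  ρ^ (k % n ℕ.+ (k / n) ℕ.* n) x    ≡⟨ ρ^-+ (k % n) ((k / n) ℕ.* n) x ⟩
  ρ^ (k % n) (ρ^ ((k / n) ℕ.* n) x) ≡⟨ cong (ρ^ (k % n)) (ρ^-multiple (k / n) x) ⟩
  ρ^ (k % n) x                      ∎

dot-∷ʳ : ∀ (xs ys : Vec Bool n) a b → dot (xs ∷ʳ a) (ys ∷ʳ b) ≡ dot xs ys xor (a ∧ b)
dot-∷ʳ []       []       a b = xor-comm (a ∧ b) false
dot-∷ʳ (x ∷ xs) (y ∷ ys) a b =
  trans (cong ((x ∧ y) xor_) (dot-∷ʳ xs ys a b)) (sym (xor-assoc (x ∧ y) (dot xs ys) (a ∧ b)))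

dot-ρ : ∀ (x y : Vec Bool n) → dot (ρ x) (ρ y) ≡ dot x y
dot-ρ []       []       = refl
dot-ρ (x ∷ xs) (y ∷ ys) = trans (dot-∷ʳ xs ys x y) (xor-comm (dot xs ys) (x ∧ y))

dot-ρ^ : ∀ k (x y : Vec Bool n) → dot (ρ^ k x) (ρ^ k y) ≡ dot x y
dot-ρ^ zero    x y = refl
dot-ρ^ (suc k) x y = trans (dot-ρ (ρ^ k x) (ρ^ k y)) (dot-ρ^ k x y)

dot-comm : ∀ (x y : Vec Bool n) → dot x y ≡ dot y x
dot-comm []       []       = refl
dot-comm (x ∷ xs) (y ∷ ys) = cong₂ _xor_ (∧-comm x y) (dot-comm xs ys)

_≤ₗ_ : Vec Bool n → Vec Bool n → Set
x ≤ₗ y = T (lexLeq x y)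

≤ₗ-refl : (x : Vec Bool n) → x ≤ₗ x
≤ₗ-refl []          = tt
≤ₗ-refl (false ∷ x) = ≤ₗ-refl x
≤ₗ-refl (true ∷ x)  = ≤ₗ-refl x

≤ₗ-trans : ∀ {x y z : Vec Bool n} → x ≤ₗ y → y ≤ₗ z → x ≤ₗ z
≤ₗ-trans {x = []}        {[]}        {[]}        _ _ = tt
≤ₗ-trans {x = false ∷ x} {false ∷ y} {false ∷ z} p q = ≤ₗ-trans {x = x} p q
≤ₗ-trans {x = false ∷ x} {false ∷ y} {true ∷ z}  _ _ = tt
≤ₗ-trans {x = false ∷ x} {true ∷ y}  {true ∷ z}  _ _ = tt
≤ₗ-trans {x = true ∷ x}  {true ∷ y}  {true ∷ z}  p q = ≤ₗ-trans {x = x} p q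
≤ₗ-trans {x = false ∷ x} {true ∷ y}  {false ∷ z} _ ()
≤ₗ-trans {x = true ∷ x}  {true ∷ y}  {false ∷ z} _ ()
≤ₗ-trans {x = true ∷ x}  {false ∷ y} ()

≤ₗ-antisym : ∀ {x y : Vec Bool n} → x ≤ₗ y → y ≤ₗ x → x ≡ y
≤ₗ-antisym {x = []}        {[]}        _ _ = refl
≤ₗ-antisym {x = false ∷ x} {false ∷ y} p q = cong (false ∷_) (≤ₗ-antisym p q)
≤ₗ-antisym {x = true ∷ x}  {true ∷ y}  p q = cong (true ∷_) (≤ₗ-antisym p q)
≤ₗ-antisym {x = false ∷ x} {true ∷ y}  _ ()
≤ₗ-antisym {x = true ∷ x}  {false ∷ y} ()

≤ₗ-total : ∀ (x y : Vec Bool n) → x ≤ₗ y ⊎ y ≤ₗ x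
≤ₗ-total []          []          = inj₁ tt
≤ₗ-total (false ∷ x) (false ∷ y) = ≤ₗ-total x y
≤ₗ-total (true ∷ x)  (true ∷ y)  = ≤ₗ-total x y
≤ₗ-total (false ∷ x) (true ∷ y)  = inj₁ tt
≤ₗ-total (true ∷ x)  (false ∷ y) = inj₂ tt

≤ₗ-totalOrder : ℕ → TotalOrder 0ℓ 0ℓ 0ℓ
≤ₗ-totalOrder n = record
  { Carrier = Vec Bool n
  ; _≈_ = _≡_
  ; _≤_ = _≤ₗ_
  ; isTotalOrder = record
    { isPartialOrder = record
      { isPreorder = record
        { isEquivalence = isEquivalence
        ; reflexive = λ { {x} refl → ≤ₗ-refl x }
        ; trans = λ {x} → ≤ₗ-trans {x = x}
        }
      ; antisym = ≤ₗ-antisym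
      }
    ; total = ≤ₗ-total
    }
  }

module LexExtrema {n} = Data.List.Extrema (≤ₗ-totalOrder n)

data _∼_ (x : Vec Bool n) : Vec Bool n → Set where
  rotate : ∀ k → x ∼ ρ^ k x

∼-refl : (x : Vec Bool n) → x ∼ x
∼-refl x = rotate 0

∼-trans : {x y z : Vec Bool n} → x ∼ y → y ∼ z → x ∼ z
∼-trans {x = x} (rotate a) (rotate b) = subst (x ∼_) (ρ^-+ b a x) (rotate (b ℕ.+ a))

∼-sym : {x y : Vec Bool n} → x ∼ y → y ∼ x
∼-sym {n = zero}  {[]} (rotate a) with ρ^ a []
... | [] = rotate 0
∼-sym {n = suc m} {x}  (rotate a) = subst (ρ^ a x ∼_) period (rotate (a ℕ.* m))
  where
  period : ρ^ (a ℕ.* m) (ρ^ a x) ≡ x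
  period = begin
    ρ^ (a ℕ.* m) (ρ^ a x) ≡⟨ ρ^-+ (a ℕ.* m) a x ⟨
    ρ^ (a ℕ.* m ℕ.+ a) x  ≡⟨ cong (λ k → ρ^ k x) (trans (+-comm (a ℕ.* m) a) (sym (*-suc a m))) ⟩
    ρ^ (a ℕ.* suc m) x    ≡⟨ ρ^-multiple a x ⟩
    x                     ∎

rotate⁻¹ : ∀ k (x : Vec Bool n) → ρ^ k x ∼ x
rotate⁻¹ k x = ∼-sym (rotate k)

inOrbit⇒∼ : (x y : Vec Bool n) → T (inOrbit x y) → x ∼ y
inOrbit⇒∼ {n} x y xy with k , ρᵏx≡y ← Any.satisfied (any⁻ _ (upTo n) xy) =
  subst (x ∼_) (toWitness ρᵏx≡y) (rotate k)

∼⇒inOrbit : .{{_ : NonZero n}} {x y : Vec Bool n} → x ∼ y → T (inOrbit x y)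
∼⇒inOrbit {n} {x} (rotate k) =
  any⁺ _ (lose (∈-upTo⁺ (m%n<n k n)) (fromWitness (sym (ρ^-% k x))))

inOrbit-ρ^ : .{{_ : NonZero n}} → ∀ k (r x : Vec Bool n) → inOrbit r (ρ^ k x) ≡ inOrbit r x
inOrbit-ρ^ k r x = T-⇔⇒≡ (mk⇔
  (λ r∼ρᵏx → ∼⇒inOrbit (∼-trans (inOrbit⇒∼ r (ρ^ k x) r∼ρᵏx) (rotate⁻¹ k x)))
  (λ r∼x → ∼⇒inOrbit (∼-trans (inOrbit⇒∼ r x r∼x) (rotate k))))

rotations : Vec Bool n → List (Vec Bool n)
rotations {n} x = map (λ k → ρ^ k x) (upTo n)

rep : Vec Bool n → Vec Bool n
rep x = LexExtrema.min x (rotations x)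

rep-∼ : (x : Vec Bool n) → rep x ∼ x
rep-∼ {n} x = LexExtrema.argmin-all (λ y → y) {P = _∼ x} (∼-refl x)
  (map⁺ (All.universal (λ k → rotate⁻¹ k x) (upTo n)))

rep-≤ₗ : .{{_ : NonZero n}} {x y : Vec Bool n} → x ∼ y → rep x ≤ₗ y
rep-≤ₗ {n} {x} (rotate k) = subst (rep x ≤ₗ_) (sym (ρ^-% k x))
  (All.lookup (LexExtrema.min≤xs x (rotations x)) (∈-map⁺ _ (∈-upTo⁺ (m%n<n k n))))

rep-isRep : .{{_ : NonZero n}} (x : Vec Bool n) → T (isRep (rep x))
rep-isRep {n} x = all⁻ _ (All.universal (λ k → rep-≤ₗ (∼-trans (∼-sym (rep-∼ x)) (rotate k))) (upTo n))

isRep-≤ₗ : .{{_ : NonZero n}} {r y : Vec Bool n} → T (isRep r) → r ∼ y → r ≤ₗ y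
isRep-≤ₗ {n} {r} r-rep (rotate k) = subst (r ≤ₗ_) (sym (ρ^-% k r))
  (All.lookup (all⁺ _ (upTo n) r-rep) (∈-upTo⁺ (m%n<n k n)))

isRep∧inOrbit : .{{_ : NonZero n}} (r x : Vec Bool n) → (isRep r ∧ inOrbit r x) ≡ ⌊ r ≟v rep x ⌋
isRep∧inOrbit r x = T-⇔⇒≡ (mk⇔
  (λ rep∧orbit → let r-rep , r∼x = Equivalence.to T-∧ rep∧orbit in
    fromWitness (≤ₗ-antisym (isRep-≤ₗ r-rep (∼-trans (inOrbit⇒∼ r x r∼x) (∼-sym (rep-∼ x))))
                            (rep-≤ₗ (∼-sym (inOrbit⇒∼ r x r∼x)))))
  (λ r≡rep → Equivalence.from T-∧ (subst (λ y → T (isRep y) × T (inOrbit y x)) (sym (toWitness r≡rep))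
    (rep-isRep x , ∼⇒inOrbit (rep-∼ x)))))

∑ : List A → (A → ℤ) → ℤ
∑ xs f = sumℤ (map f xs)

infix 5 ∑
syntax ∑ xs (λ x → e) = ∑[ x ← xs ] e

infix 5 _when_

_when_ : ℤ → Bool → ℤ
a when true  = a
a when false = 0ℤ

∑-cong : (xs : List A) {f g : A → ℤ} → (∀ x → f x ≡ g x) → ∑ xs f ≡ ∑ xs g
∑-cong xs f≗g = cong sumℤ (map-cong f≗g xs)

∑-map : (xs : List A) (g : A → B) (f : B → ℤ) → ∑ (map g xs) f ≡ ∑ xs (f ∘ g)
∑-map xs g f = cong sumℤ (sym (map-∘ xs))

∑-++ : (xs ys : List A) (f : A → ℤ) → ∑ (xs ++ ys) f ≡ ∑ xs f + ∑ ys f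
∑-++ []       ys f = sym (ℤ.+-identityˡ (∑ ys f))
∑-++ (x ∷ xs) ys f = trans (cong (_+_ (f x)) (∑-++ xs ys f)) (sym (ℤ.+-assoc (f x) (∑ xs f) (∑ ys f)))

∑-zero : (xs : List A) → ∑[ x ← xs ] 0ℤ ≡ 0ℤ
∑-zero []       = refl
∑-zero (x ∷ xs) = trans (ℤ.+-identityˡ _) (∑-zero xs)

∑-+ : (xs : List A) (f g : A → ℤ) → ∑[ x ← xs ] (f x + g x) ≡ ∑ xs f + ∑ xs g
∑-+ []       f g = refl
∑-+ (x ∷ xs) f g = trans (cong (_+_ (f x + g x)) (∑-+ xs f g))
  (interchange (f x) (g x) (∑ xs f) (∑ xs g))
  where open import Algebra.Properties.CommutativeSemigroup ℤ.+-commutativeSemigroup using (interchange)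

∑-comm : (xs : List A) (ys : List B) (f : A → B → ℤ) →
         ∑[ x ← xs ] ∑[ y ← ys ] f x y ≡ ∑[ y ← ys ] ∑[ x ← xs ] f x y
∑-comm []       ys f = sym (∑-zero ys)
∑-comm (x ∷ xs) ys f = trans (cong (_+_ (∑ ys (f x))) (∑-comm xs ys f))
  (sym (∑-+ ys (f x) (λ y → ∑[ x ← xs ] f x y)))

*-distribˡ-∑ : (c : ℤ) (xs : List A) (f : A → ℤ) → c * ∑ xs f ≡ ∑[ x ← xs ] c * f x
*-distribˡ-∑ c []       f = ℤ.*-zeroʳ c
*-distribˡ-∑ c (x ∷ xs) f = trans (ℤ.*-distribˡ-+ c (f x) (∑ xs f)) (cong (_+_ (c * f x)) (*-distribˡ-∑ c xs f))

∑-const : (xs : List A) (c : ℤ) → ∑[ x ← xs ] c ≡ + length xs * c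
∑-const []       c = sym (ℤ.*-zeroˡ c)
∑-const (x ∷ xs) c = begin
  c + (∑[ y ← xs ] c)       ≡⟨ cong₂ _+_ (sym (ℤ.*-identityˡ c)) (∑-const xs c) ⟩
  + 1 * c + + length xs * c ≡⟨ ℤ.*-distribʳ-+ c (+ 1) (+ length xs) ⟨
  + suc (length xs) * c     ∎

∑-filter : (xs : List A) (p : A → Bool) (f : A → ℤ) →
           ∑ (filter (λ x → p x Bool.≟ true) xs) f ≡ ∑[ x ← xs ] (f x when p x)
∑-filter []       p f = refl
∑-filter (x ∷ xs) p f with p x
... | true  = cong (_+_ (f x)) (∑-filter xs p f)
... | false = trans (∑-filter xs p f) (sym (ℤ.+-identityˡ _))

∑-when : (xs : List A) (f : A → ℤ) (b : Bool) → (∑ xs f when b) ≡ ∑[ x ← xs ] (f x when b)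
∑-when xs f true  = refl
∑-when xs f false = sym (∑-zero xs)

*-when : ∀ c a b → c * (a when b) ≡ (c * a when b)
*-when c a true  = refl
*-when c a false = ℤ.*-zeroʳ c

when-when : ∀ a b c → ((a when c) when b) ≡ (a when b ∧ c)
when-when a true  c = refl
when-when a false c = refl

∑-upTo-suc : ∀ n (f : ℕ → ℤ) → ∑ (upTo (suc n)) f ≡ f 0 + (∑[ k ← upTo n ] f (suc k))
∑-upTo-suc n f = cong (_+_ (f 0)) (trans (cong (λ ks → ∑ ks f) (sym (map-upTo suc n))) (∑-map (upTo n) suc f))

∑-upTo-∷ʳ : ∀ n (f : ℕ → ℤ) → ∑ (upTo (suc n)) f ≡ ∑ (upTo n) f + f n
∑-upTo-∷ʳ n f = begin
  ∑ (upTo (suc n)) f             ≡⟨ cong (λ ks → ∑ ks f) (upTo-∷ʳ n) ⟨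
  ∑ (upTo n ++ [ n ]) f          ≡⟨ ∑-++ (upTo n) [ n ] f ⟩
  ∑ (upTo n) f + (f n + 0ℤ)      ≡⟨ cong (_+_ (∑ (upTo n) f)) (ℤ.+-identityʳ (f n)) ⟩
  ∑ (upTo n) f + f n             ∎

∑-upTo-rotate : ∀ n (f : ℕ → ℤ) → f n ≡ f 0 → ∑[ k ← upTo n ] f (suc k) ≡ ∑ (upTo n) f
∑-upTo-rotate n f fn≡f0 = ∙-cancelˡ (f 0) _ _ (begin
  f 0 + (∑[ k ← upTo n ] f (suc k)) ≡⟨ ∑-upTo-suc n f ⟨
  ∑ (upTo (suc n)) f                ≡⟨ ∑-upTo-∷ʳ n f ⟩
  ∑ (upTo n) f + f n                ≡⟨ cong (_+_ (∑ (upTo n) f)) fn≡f0 ⟩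
  ∑ (upTo n) f + f 0                ≡⟨ ℤ.+-comm (∑ (upTo n) f) (f 0) ⟩
  f 0 + ∑ (upTo n) f                ∎)
  where open import Algebra.Properties.Group (AbelianGroup.group ℤ.+-0-abelianGroup) using (∙-cancelˡ)

∑-upTo-shift : ∀ n (f : ℕ → ℤ) → (∀ k → f (n ℕ.+ k) ≡ f k) →
               ∀ c → ∑[ k ← upTo n ] f (c ℕ.+ k) ≡ ∑ (upTo n) f
∑-upTo-shift n f periodic zero    = refl
∑-upTo-shift n f periodic (suc c) = begin
  ∑[ k ← upTo n ] f (suc (c ℕ.+ k)) ≡⟨ ∑-upTo-shift n (f ∘ suc) periodic-suc c ⟩
  ∑[ k ← upTo n ] f (suc k)         ≡⟨ ∑-upTo-rotate n f (trans (cong f (sym (+-identityʳ n))) (periodic 0)) ⟩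
  ∑ (upTo n) f                      ∎
  where
  periodic-suc : ∀ k → f (suc (n ℕ.+ k)) ≡ f (suc k)
  periodic-suc k = trans (cong f (sym (+-suc n k))) (periodic (suc k))

∑-allVecs-∷ : ∀ n (F : Vec Bool (suc n) → ℤ) →
              ∑ (allVecs (suc n)) F ≡ (∑[ x ← allVecs n ] F (false ∷ x)) + (∑[ x ← allVecs n ] F (true ∷ x))
∑-allVecs-∷ n F = trans (∑-++ (map (false ∷_) (allVecs n)) _ F)
  (cong₂ _+_ (∑-map (allVecs n) (false ∷_) F) (∑-map (allVecs n) (true ∷_) F))

∑-allVecs-∷ʳ : ∀ n (F : Vec Bool (suc n) → ℤ) →
               ∑ (allVecs (suc n)) F ≡ ∑[ x ← allVecs n ] (F (x ∷ʳ false) + F (x ∷ʳ true))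
∑-allVecs-∷ʳ zero    F = sym (ℤ.+-assoc (F (false ∷ [])) (F (true ∷ [])) 0ℤ)
∑-allVecs-∷ʳ (suc n) F = begin
  ∑ (allVecs (suc (suc n))) F
    ≡⟨ ∑-allVecs-∷ (suc n) F ⟩
  (∑[ x ← allVecs (suc n) ] F (false ∷ x)) + (∑[ x ← allVecs (suc n) ] F (true ∷ x))
    ≡⟨ cong₂ _+_ (∑-allVecs-∷ʳ n (F ∘ (false ∷_))) (∑-allVecs-∷ʳ n (F ∘ (true ∷_))) ⟩
  (∑[ x ← allVecs n ] (F (false ∷ (x ∷ʳ false)) + F (false ∷ (x ∷ʳ true)))) +
  (∑[ x ← allVecs n ] (F (true ∷ (x ∷ʳ false)) + F (true ∷ (x ∷ʳ true))))
    ≡⟨ ∑-allVecs-∷ n _ ⟨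
  ∑[ x ← allVecs (suc n) ] (F (x ∷ʳ false) + F (x ∷ʳ true))
    ∎

∑-allVecs-ρ : ∀ n (F : Vec Bool n → ℤ) → ∑[ x ← allVecs n ] F (ρ x) ≡ ∑ (allVecs n) F
∑-allVecs-ρ zero    F = refl
∑-allVecs-ρ (suc n) F = begin
  ∑[ x ← allVecs (suc n) ] F (ρ x)
    ≡⟨ ∑-allVecs-∷ n (F ∘ ρ) ⟩
  (∑[ x ← allVecs n ] F (x ∷ʳ false)) + (∑[ x ← allVecs n ] F (x ∷ʳ true))
    ≡⟨ ∑-+ (allVecs n) _ _ ⟨
  ∑[ x ← allVecs n ] (F (x ∷ʳ false) + F (x ∷ʳ true))
    ≡⟨ ∑-allVecs-∷ʳ n F ⟨
  ∑ (allVecs (suc n)) F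
    ∎

∑-allVecs-ρ^ : ∀ n k (F : Vec Bool n → ℤ) → ∑[ x ← allVecs n ] F (ρ^ k x) ≡ ∑ (allVecs n) F
∑-allVecs-ρ^ n zero    F = refl
∑-allVecs-ρ^ n (suc k) F = trans (∑-allVecs-ρ^ n k (F ∘ ρ)) (∑-allVecs-ρ n F)

-- isYes (= ⌊_⌋) is stuck on an open Dec, while does computes through ≡-dec.
⌊≟v⌋-∷ : ∀ a b (x y : Vec Bool n) → ⌊ (a ∷ x) ≟v (b ∷ y) ⌋ ≡ ⌊ a Bool.≟ b ⌋ ∧ ⌊ x ≟v y ⌋
⌊≟v⌋-∷ a b x y = trans (isYes≗does _) (cong₂ _∧_ (sym (isYes≗does (a Bool.≟ b))) (sym (isYes≗does (x ≟v y))))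

∑-allVecs-indicator : ∀ n (y : Vec Bool n) (c : ℤ) → ∑[ x ← allVecs n ] (c when ⌊ x ≟v y ⌋) ≡ c
∑-allVecs-indicator zero    []      c = ℤ.+-identityʳ c
∑-allVecs-indicator (suc n) (b ∷ y) c = begin
  ∑[ x ← allVecs (suc n) ] (c when ⌊ x ≟v (b ∷ y) ⌋)
    ≡⟨ ∑-allVecs-∷ n _ ⟩
  (∑[ x ← allVecs n ] (c when ⌊ (false ∷ x) ≟v (b ∷ y) ⌋)) + (∑[ x ← allVecs n ] (c when ⌊ (true ∷ x) ≟v (b ∷ y) ⌋))
    ≡⟨ cong₂ _+_ (∑-cong (allVecs n) (λ x → cong (c when_) (⌊≟v⌋-∷ false b x y)))
                 (∑-cong (allVecs n) (λ x → cong (c when_) (⌊≟v⌋-∷ true b x y))) ⟩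
  (∑[ x ← allVecs n ] (c when ⌊ false Bool.≟ b ⌋ ∧ ⌊ x ≟v y ⌋)) + (∑[ x ← allVecs n ] (c when ⌊ true Bool.≟ b ⌋ ∧ ⌊ x ≟v y ⌋))
    ≡⟨ halves b ⟩
  c ∎
  where
  halves : ∀ b → (∑[ x ← allVecs n ] (c when ⌊ false Bool.≟ b ⌋ ∧ ⌊ x ≟v y ⌋)) +
                 (∑[ x ← allVecs n ] (c when ⌊ true Bool.≟ b ⌋ ∧ ⌊ x ≟v y ⌋)) ≡ c
  halves false = trans (cong₂ _+_ (∑-allVecs-indicator n y c) (∑-zero (allVecs n))) (ℤ.+-identityʳ c)
  halves true  = trans (cong₂ _+_ (∑-zero (allVecs n)) (∑-allVecs-indicator n y c)) (ℤ.+-identityˡ c)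

∑-allFin-lookup : (xs : List A) (f : A → ℤ) → ∑[ i ← allFin (length xs) ] f (List.lookup xs i) ≡ ∑ xs f
∑-allFin-lookup xs f = cong sumℤ (begin
  map (f ∘ List.lookup xs) (tabulate (λ i → i)) ≡⟨ map-tabulate (λ i → i) (f ∘ List.lookup xs) ⟩
  tabulate (f ∘ List.lookup xs)                ≡⟨ map-tabulate (List.lookup xs) f ⟨
  map f (tabulate (List.lookup xs))            ≡⟨ cong (map f) (tabulate-lookup xs) ⟩
  map f xs                                     ∎)

∑-orbits : ∀ n .{{_ : NonZero n}} (F : Vec Bool n → ℤ) →
           ∑[ r ← allVecs n ] ((∑[ x ← allVecs n ] (F x when inOrbit r x)) when isRep r) ≡ ∑ (allVecs n) F
∑-orbits n F = begin
  ∑[ r ← allVecs n ] ((∑[ x ← allVecs n ] (F x when inOrbit r x)) when isRep r)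
    ≡⟨ ∑-cong (allVecs n) (λ r → trans (∑-when (allVecs n) _ (isRep r))
         (∑-cong (allVecs n) (λ x → trans (when-when (F x) (isRep r) (inOrbit r x))
                                          (cong (F x when_) (isRep∧inOrbit r x))))) ⟩
  ∑[ r ← allVecs n ] ∑[ x ← allVecs n ] (F x when ⌊ r ≟v rep x ⌋)
    ≡⟨ ∑-comm (allVecs n) (allVecs n) _ ⟩
  ∑[ x ← allVecs n ] ∑[ r ← allVecs n ] (F x when ⌊ r ≟v rep x ⌋)
    ≡⟨ ∑-cong (allVecs n) (λ x → ∑-allVecs-indicator n (rep x) (F x)) ⟩
  ∑ (allVecs n) F
    ∎

diagonal : Vec Bool n → ℤ
diagonal {n} r = ∑[ x ← allVecs n ] (sgn (dot x r) when inOrbit r x)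

rotationSum : Vec Bool n → ℤ
rotationSum {n} x = ∑[ k ← upTo n ] sgn (dot x (ρ^ k x))

Tr≡∑-diagonal : ∀ n → Tr n ≡ ∑[ r ← allVecs n ] (diagonal r when isRep r)
Tr≡∑-diagonal n = begin
  ∑[ i ← allFin (g n) ] 𝒜 n i i          ≡⟨ ∑-cong (allFin (g n)) (λ i → ∑-filter (allVecs n) (inOrbit (Λ n i)) _) ⟩
  ∑[ i ← allFin (g n) ] diagonal (Λ n i) ≡⟨ ∑-allFin-lookup (reps n) diagonal ⟩
  ∑ (reps n) diagonal                    ≡⟨ ∑-filter (allVecs n) isRep diagonal ⟩
  ∑[ r ← allVecs n ] (diagonal r when isRep r) ∎

∑-dot-rotations : {x r : Vec Bool n} → x ∼ r → ∑[ k ← upTo n ] sgn (dot (ρ^ k x) r) ≡ rotationSum x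
∑-dot-rotations {n} {x} (rotate c) = begin
  ∑[ k ← upTo n ] f k         ≡⟨ ∑-upTo-shift n f periodic c ⟨
  ∑[ k ← upTo n ] f (c ℕ.+ k) ≡⟨ ∑-cong (upTo n) (λ k → cong sgn (dot-shift k)) ⟩
  rotationSum x               ∎
  where
  f : ℕ → ℤ
  f k = sgn (dot (ρ^ k x) (ρ^ c x))
  periodic : ∀ k → f (n ℕ.+ k) ≡ f k
  periodic k = cong (λ y → sgn (dot y (ρ^ c x))) (trans (ρ^-+ n k x) (ρ^-period (ρ^ k x)))
  dot-shift : ∀ k → dot (ρ^ (c ℕ.+ k) x) (ρ^ c x) ≡ dot x (ρ^ k x)
  dot-shift k = begin
    dot (ρ^ (c ℕ.+ k) x) (ρ^ c x)  ≡⟨ cong (λ y → dot y (ρ^ c x)) (ρ^-+ c k x) ⟩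
    dot (ρ^ c (ρ^ k x)) (ρ^ c x)   ≡⟨ dot-ρ^ c (ρ^ k x) x ⟩
    dot (ρ^ k x) x                 ≡⟨ dot-comm (ρ^ k x) x ⟩
    dot x (ρ^ k x)                 ∎

n*diagonal : .{{_ : NonZero n}} (r : Vec Bool n) →
             + n * diagonal r ≡ ∑[ x ← allVecs n ] (rotationSum x when inOrbit r x)
n*diagonal {n} r = begin
  + n * diagonal r
    ≡⟨ cong (λ l → + l * diagonal r) (length-upTo n) ⟨
  + length (upTo n) * diagonal r
    ≡⟨ ∑-const (upTo n) (diagonal r) ⟨
  ∑[ k ← upTo n ] diagonal r
    ≡⟨ ∑-cong (upTo n) (λ k → ∑-allVecs-ρ^ n k term) ⟨
  ∑[ k ← upTo n ] ∑[ x ← allVecs n ] (sgn (dot (ρ^ k x) r) when inOrbit r (ρ^ k x))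
    ≡⟨ ∑-cong (upTo n) (λ k → ∑-cong (allVecs n) (λ x → cong (sgn (dot (ρ^ k x) r) when_) (inOrbit-ρ^ k r x))) ⟩
  ∑[ k ← upTo n ] ∑[ x ← allVecs n ] (sgn (dot (ρ^ k x) r) when inOrbit r x)
    ≡⟨ ∑-comm (upTo n) (allVecs n) _ ⟩
  ∑[ x ← allVecs n ] ∑[ k ← upTo n ] (sgn (dot (ρ^ k x) r) when inOrbit r x)
    ≡⟨ ∑-cong (allVecs n) (λ x → ∑-when (upTo n) _ (inOrbit r x)) ⟨
  ∑[ x ← allVecs n ] ((∑[ k ← upTo n ] sgn (dot (ρ^ k x) r)) when inOrbit r x)
    ≡⟨ ∑-cong (allVecs n) orbit-term ⟩
  ∑[ x ← allVecs n ] (rotationSum x when inOrbit r x)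
    ∎
  where
  term : Vec Bool n → ℤ
  term x = sgn (dot x r) when inOrbit r x
  orbit-term : ∀ x → ((∑[ k ← upTo n ] sgn (dot (ρ^ k x) r)) when inOrbit r x) ≡ (rotationSum x when inOrbit r x)
  orbit-term x with inOrbit r x in r∼x
  ... | true  = ∑-dot-rotations (∼-sym (inOrbit⇒∼ r x (Equivalence.from T-≡ r∼x)))
  ... | false = refl

proposition1 : (n : ℕ) → 2 < n → (+ n) * Tr n ≡ rhsSum n
proposition1 zero    ()
proposition1 n@(suc _) _ = begin
  + n * Tr n
    ≡⟨ cong (+ n *_) (Tr≡∑-diagonal n) ⟩
  + n * (∑[ r ← allVecs n ] (diagonal r when isRep r))
    ≡⟨ *-distribˡ-∑ (+ n) (allVecs n) _ ⟩
  ∑[ r ← allVecs n ] (+ n * (diagonal r when isRep r))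
    ≡⟨ ∑-cong (allVecs n) (λ r → trans (*-when (+ n) (diagonal r) (isRep r)) (cong (_when isRep r) (n*diagonal r))) ⟩
  ∑[ r ← allVecs n ] ((∑[ x ← allVecs n ] (rotationSum x when inOrbit r x)) when isRep r)
    ≡⟨ ∑-orbits n rotationSum ⟩
  ∑[ x ← allVecs n ] rotationSum x
    ≡⟨ ∑-comm (allVecs n) (upTo n) _ ⟩
  rhsSum n
    ∎
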